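{- For every set $\mathsf{Ax}$ of formulas, the logic $\mathsf{CK}\oplus\mathsf{Ax}$ is the logic preserving degrees of truth over the class $\mathrm{Alg}(\mathsf{Ax})$ of CK-algebras satisfying $\mathsf{Ax}$: for every set $\Lambda$ of formulas and every formula $\phi$, $\Lambda\vdash_{\mathsf{Ax}}\phi$ if and only if there exists a finite $\Lambda'\subseteq\Lambda$ such that for every $\mathcal{A}\in\mathrm{Alg}(\mathsf{Ax})$, every valuation $v$ on $\mathcal{A}$ and every $a\in A$: if $a\le[\![\psi]\!]_v$ for all $\psi\in\Lambda'$, then $a\le[\![\phi]\!]_v$.
   Context: Formulas: $\phi::=p\mid\bot\mid\phi\wedge\phi\mid\phi\vee\phi\mid\phi\to\phi\mid\Box\phi\mid\Diamond\phi$ over a set $\mathrm{Prop}$ of variables, $\top:=\bot\to\bot$. $\mathsf{CK}\oplus\mathsf{Ax}$ is axiomatized by all substitution instances of the axioms of intuitionistic propositional logic, of $\Box(\phi\to\psi)\to(\Box\phi\to\Box\psi)$, of $\Box(\phi\to\psi)\to(\Diamond\phi\to\Diamond\psi)$, and of the formulas in $\mathsf{Ax}$, with rules modus ponens and necessitation (from a theorem $\phi$ infer $\Box\phi$). $\Lambda\vdash_{\mathsf{Ax}}\phi$ means $\phi$ is derivable from premises $\Lambda$ using theorems of $\mathsf{CK}\oplus\mathsf{Ax}$ and modus ponens (necessitation only applies to theorems). A CK-algebra is a Heyting algebra $(A,\top,\bot,\wedge,\vee,\to)$ with unary $\Box,\Diamond$ satisfying $\Box\top=\top$, $\Box a\wedge\Box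 b=\Box(a\wedge b)$, $\Diamond a\le\Diamond(a\vee b)$, $\Box a\wedge\Diamond b\le\Diamond(a\wedge b)$. A valuation is $v:\mathrm{Prop}\to A$; $[\![\phi]\!]_v$ is defined by $[\![p]\!]_v=v(p)$, $[\![\bot]\!]_v=\bot$, and commuting with $\wedge,\vee,\to,\Box,\Diamond$. $\mathcal{A}$ satisfies $\phi$ if $[\![\phi]\!]_v=\top$ for all valuations $v$; $\mathrm{Alg}(\mathsf{Ax})$ is the class of CK-algebras satisfying every formula in $\mathsf{Ax}$. -}

module Defs where

open import Level using (0ℓ)
open import Data.List using (List)
open import Data.List.Relation.Unary.All using (All)
open import Relation.Binary.Lattice.Bundles using (HeytingAlgebra)

data Formula (Prop : Set) : Set where
  var  : Prop → Formula Prop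
  ⊥'   : Formula Prop
  _∧'_ : Formula Prop → Formula Prop → Formula Prop
  _∨'_ : Formula Prop → Formula Prop → Formula Prop
  _⇒_  : Formula Prop → Formula Prop → Formula Prop
  □_   : Formula Prop → Formula Prop
  ◇_   : Formula Prop → Formula Prop

infixr 5 _⇒_
infixr 6 _∨'_
infixr 7 _∧'_
infix 8 □_ ◇_

⊤' : {Prop : Set} → Formula Prop
⊤' = ⊥' ⇒ ⊥'

FormulaSet : Set → Set₁
FormulaSet Prop = Formula Prop → Set

subst : {Prop : Set} → (Prop → Formula Prop) → Formula Prop → Formula Prop
subst σ (var p) = σ p
subst σ ⊥' = ⊥'
subst σ (φ ∧' ψ) = subst σ φ ∧' subst σ ψ
subst σ (φ ∨' ψ) = subst σ φ ∨' subst σ ψ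
subst σ (φ ⇒ ψ) = subst σ φ ⇒ subst σ ψ
subst σ (□ φ) = □ subst σ φ
subst σ (◇ φ) = ◇ subst σ φ

data Thm {Prop : Set} (Ax : FormulaSet Prop) : Formula Prop → Set where
  ipc-K   : ∀ φ ψ → Thm Ax (φ ⇒ ψ ⇒ φ)
  ipc-S   : ∀ φ ψ χ → Thm Ax ((φ ⇒ ψ ⇒ χ) ⇒ (φ ⇒ ψ) ⇒ φ ⇒ χ)
  ipc-∧E₁ : ∀ φ ψ → Thm Ax (φ ∧' ψ ⇒ φ)
  ipc-∧E₂ : ∀ φ ψ → Thm Ax (φ ∧' ψ ⇒ ψ)
  ipc-∧I  : ∀ φ ψ → Thm Ax (φ ⇒ ψ ⇒ φ ∧' ψ)
  ipc-∨I₁ : ∀ φ ψ → Thm Ax (φ ⇒ φ ∨' ψ)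
  ipc-∨I₂ : ∀ φ ψ → Thm Ax (ψ ⇒ φ ∨' ψ)
  ipc-∨E  : ∀ φ ψ χ → Thm Ax ((φ ⇒ χ) ⇒ (ψ ⇒ χ) ⇒ φ ∨' ψ ⇒ χ)
  ipc-⊥E  : ∀ φ → Thm Ax (⊥' ⇒ φ)
  K□      : ∀ φ ψ → Thm Ax (□ (φ ⇒ ψ) ⇒ □ φ ⇒ □ ψ)
  K◇      : ∀ φ ψ → Thm Ax (□ (φ ⇒ ψ) ⇒ ◇ φ ⇒ ◇ ψ)
  ax      : ∀ ψ (σ : Prop → Formula Prop) → Ax ψ → Thm Ax (subst σ ψ)
  mp      : ∀ {φ ψ} → Thm Ax (φ ⇒ ψ) → Thm Ax φ → Thm Ax ψ
  nec     : ∀ {φ} → Thm Ax φ → Thm Ax (□ φ)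

-- Λ ⊢_Ax φ : derivable from premises Λ using theorems of CK ⊕ Ax and
-- modus ponens (necessitation only on theorems).
data _⊢[_]_ {Prop : Set} (Λ : FormulaSet Prop) (Ax : FormulaSet Prop)
     : Formula Prop → Set where
  premise : ∀ {φ} → Λ φ → Λ ⊢[ Ax ] φ
  theorem : ∀ {φ} → Thm Ax φ → Λ ⊢[ Ax ] φ
  mp      : ∀ {φ ψ} → Λ ⊢[ Ax ] (φ ⇒ ψ) → Λ ⊢[ Ax ] φ → Λ ⊢[ Ax ] ψ

record CKAlgebra : Set₁ where
  field
    heyting : HeytingAlgebra 0ℓ 0ℓ 0ℓ
  open HeytingAlgebra heyting public
  field
    □ᴬ : Carrier → Carrier
    ◇ᴬ : Carrier → Carrier
    □-cong : ∀ {a b} → a ≈ b → □ᴬ a ≈ □ᴬ b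
    ◇-cong : ∀ {a b} → a ≈ b → ◇ᴬ a ≈ ◇ᴬ b
    □-⊤  : □ᴬ ⊤ ≈ ⊤
    □-∧  : ∀ a b → (□ᴬ a ∧ □ᴬ b) ≈ □ᴬ (a ∧ b)
    ◇-∨  : ∀ a b → ◇ᴬ a ≤ ◇ᴬ (a ∨ b)
    □◇   : ∀ a b → (□ᴬ a ∧ ◇ᴬ b) ≤ ◇ᴬ (a ∧ b)

module _ (𝔸 : CKAlgebra) where
  open CKAlgebra 𝔸

  ⟦_⟧ : {Prop : Set} → Formula Prop → (Prop → Carrier) → Carrier
  ⟦ var p ⟧ v = v p
  ⟦ ⊥' ⟧ v = ⊥
  ⟦ φ ∧' ψ ⟧ v = ⟦ φ ⟧ v ∧ ⟦ ψ ⟧ v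
  ⟦ φ ∨' ψ ⟧ v = ⟦ φ ⟧ v ∨ ⟦ ψ ⟧ v
  ⟦ φ ⇒ ψ ⟧ v = ⟦ φ ⟧ v ⇨ ⟦ ψ ⟧ v
  ⟦ □ φ ⟧ v = □ᴬ (⟦ φ ⟧ v)
  ⟦ ◇ φ ⟧ v = ◇ᴬ (⟦ φ ⟧ v)

  Satisfies : {Prop : Set} → Formula Prop → Set
  Satisfies {Prop} φ = ∀ (v : Prop → Carrier) → ⟦ φ ⟧ v ≈ ⊤

InAlg : {Prop : Set} → FormulaSet Prop → CKAlgebra → Set
InAlg Ax 𝔸 = ∀ ψ → Ax ψ → Satisfies 𝔸 ψ

FiniteSubsetOf : {Prop : Set} → List (Formula Prop) → FormulaSet Prop → Set
FiniteSubsetOf Λ' Λ = All Λ Λ'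

DegreeConseq : {Prop : Set} → FormulaSet Prop → List (Formula Prop)
             → Formula Prop → Set₁
DegreeConseq {Prop} Ax Λ' φ =
  ∀ (𝔸 : CKAlgebra) → InAlg Ax 𝔸 →
  ∀ (v : Prop → CKAlgebra.Carrier 𝔸) (a : CKAlgebra.Carrier 𝔸) →
  All (λ ψ → CKAlgebra._≤_ 𝔸 a (⟦_⟧ 𝔸 ψ v)) Λ' →
  CKAlgebra._≤_ 𝔸 a (⟦_⟧ 𝔸 φ v)

{-# OPTIONS --safe #-}
-- Soundness: in any algebra of Alg(Ax) every theorem of CK ⊕ Ax evaluates to ⊤, and
-- a ≤ ⟦ φ ⇒ ψ ⟧ together with a ≤ ⟦ φ ⟧ gives a ≤ ⟦ ψ ⟧, so a derivation is a
-- degree-of-truth consequence of the finitely many premises it uses.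
-- Completeness: formulas ordered by provable implication form a CK-algebra in
-- Alg(Ax), the Lindenbaum algebra, where the valuation var gives each formula itself
-- as its value. Taking a = ⋀ Λ' there turns the degree-of-truth consequence into
-- ⊢ ⋀ Λ' ⇒ φ, and ⋀ Λ' is derivable from Λ.
module Submission where

open import Defs
open import Data.List using (List; []; _∷_; [_]; _++_)
open import Data.List.Membership.Propositional using (_∈_)
open import Data.List.Relation.Unary.Any using (here; there)
open import Data.List.Relation.Unary.All as All using (All; []; _∷_)
open import Data.List.Relation.Unary.All.Properties using (++⁺; ++⁻ˡ; ++⁻ʳ)
open import Data.Product using (Σ; _×_; _,_; proj₁)
open import Function.Bundles using (_⇔_; mk⇔)
open import Level using (0ℓ)
open import Relation.Binary.Lattice.Bundles using (HeytingAlgebra)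
open import Relation.Binary.Lattice.Definitions using (Supremum; Infimum; Exponential)
open import Relation.Binary.Structures using (IsPartialOrder)
open import Relation.Binary.PropositionalEquality as ≡ using (_≡_; refl; cong; cong₂)

module CKAlgebraProperties (𝔸 : CKAlgebra) where
  open CKAlgebra 𝔸
  open import Relation.Binary.Lattice.Properties.HeytingAlgebra heyting
    using (⇨-eval; ⇨ʳ-covariant; ⇨-distribˡ-∧-≥)
  open import Relation.Binary.Lattice.Properties.MeetSemilattice meetSemilattice
    using (y≤x⇒x∧y≈y)
  open import Relation.Binary.Lattice.Properties.JoinSemilattice joinSemilattice
    using (x≤y⇒x∨y≈y)
  open import Relation.Binary.Reasoning.PartialOrder poset

  ⇨-mp : ∀ {w x y} → w ≤ x ⇨ y → w ≤ x → w ≤ y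
  ⇨-mp w≤x⇨y w≤x = trans (∧-greatest w≤x⇨y w≤x) ⇨-eval

  ⊤≤⇨ : ∀ {x y} → x ≤ y → ⊤ ≤ x ⇨ y
  ⊤≤⇨ x≤y = transpose-⇨ (trans (x∧y≤y _ _) x≤y)

  ⇨-distribˡ-⇨ : ∀ x y z → x ⇨ (y ⇨ z) ≤ (x ⇨ y) ⇨ (x ⇨ z)
  ⇨-distribˡ-⇨ x y z = transpose-⇨ (trans (⇨-distribˡ-∧-≥ x (y ⇨ z) y) (⇨ʳ-covariant ⇨-eval))

  □-mono : ∀ {x y} → x ≤ y → □ᴬ x ≤ □ᴬ y
  □-mono {x} {y} x≤y = begin
    □ᴬ x          ≈⟨ □-cong (Eq.sym (y≤x⇒x∧y≈y x≤y)) ⟩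
    □ᴬ (y ∧ x)    ≈⟨ Eq.sym (□-∧ y x) ⟩
    □ᴬ y ∧ □ᴬ x   ≤⟨ x∧y≤x _ _ ⟩
    □ᴬ y          ∎

  ◇-mono : ∀ {x y} → x ≤ y → ◇ᴬ x ≤ ◇ᴬ y
  ◇-mono {x} {y} x≤y = begin
    ◇ᴬ x          ≤⟨ ◇-∨ x y ⟩
    ◇ᴬ (x ∨ y)    ≈⟨ ◇-cong (x≤y⇒x∨y≈y x≤y) ⟩
    ◇ᴬ y          ∎

  □-distrib-⇨ : ∀ x y → □ᴬ (x ⇨ y) ≤ □ᴬ x ⇨ □ᴬ y
  □-distrib-⇨ x y = transpose-⇨ (trans (reflexive (□-∧ _ _)) (□-mono ⇨-eval))

  □◇-distrib-⇨ : ∀ x y → □ᴬ (x ⇨ y) ≤ ◇ᴬ x ⇨ ◇ᴬ y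
  □◇-distrib-⇨ x y = transpose-⇨ (trans (□◇ _ _) (◇-mono ⇨-eval))

module Soundness (𝔸 : CKAlgebra) where
  open CKAlgebra 𝔸 renaming (refl to ≤-refl)
  open import Relation.Binary.Lattice.Properties.HeytingAlgebra heyting
    using (y≤x⇨y; ⇨-distribˡ-∨-∧-≥)
  open CKAlgebraProperties 𝔸

  ⟦⟧-subst : {P : Set} (σ : P → Formula P) (ψ : Formula P) (v : P → Carrier) →
             ⟦ 𝔸 ⟧ (subst σ ψ) v ≡ ⟦ 𝔸 ⟧ ψ (λ p → ⟦ 𝔸 ⟧ (σ p) v)
  ⟦⟧-subst σ (var p)  v = refl
  ⟦⟧-subst σ ⊥'       v = refl
  ⟦⟧-subst σ (φ ∧' ψ) v = cong₂ _∧_ (⟦⟧-subst σ φ v) (⟦⟧-subst σ ψ v)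
  ⟦⟧-subst σ (φ ∨' ψ) v = cong₂ _∨_ (⟦⟧-subst σ φ v) (⟦⟧-subst σ ψ v)
  ⟦⟧-subst σ (φ ⇒ ψ)  v = cong₂ _⇨_ (⟦⟧-subst σ φ v) (⟦⟧-subst σ ψ v)
  ⟦⟧-subst σ (□ φ)    v = cong □ᴬ (⟦⟧-subst σ φ v)
  ⟦⟧-subst σ (◇ φ)    v = cong ◇ᴬ (⟦⟧-subst σ φ v)

  Thm-sound : {P : Set} {Ax : FormulaSet P} → InAlg Ax 𝔸 →
              ∀ {φ} → Thm Ax φ → (v : P → Carrier) → ⊤ ≤ ⟦ 𝔸 ⟧ φ v
  Thm-sound 𝔸⊨Ax (ipc-K φ ψ)     v = ⊤≤⇨ y≤x⇨y
  Thm-sound 𝔸⊨Ax (ipc-S φ ψ χ)   v = ⊤≤⇨ (⇨-distribˡ-⇨ _ _ _)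
  Thm-sound 𝔸⊨Ax (ipc-∧E₁ φ ψ)   v = ⊤≤⇨ (x∧y≤x _ _)
  Thm-sound 𝔸⊨Ax (ipc-∧E₂ φ ψ)   v = ⊤≤⇨ (x∧y≤y _ _)
  Thm-sound 𝔸⊨Ax (ipc-∧I φ ψ)    v = ⊤≤⇨ (transpose-⇨ ≤-refl)
  Thm-sound 𝔸⊨Ax (ipc-∨I₁ φ ψ)   v = ⊤≤⇨ (x≤x∨y _ _)
  Thm-sound 𝔸⊨Ax (ipc-∨I₂ φ ψ)   v = ⊤≤⇨ (y≤x∨y _ _)
  Thm-sound 𝔸⊨Ax (ipc-∨E φ ψ χ)  v = ⊤≤⇨ (transpose-⇨ (⇨-distribˡ-∨-∧-≥ _ _ _))
  Thm-sound 𝔸⊨Ax (ipc-⊥E φ)      v = ⊤≤⇨ (minimum _)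
  Thm-sound 𝔸⊨Ax (K□ φ ψ)        v = ⊤≤⇨ (□-distrib-⇨ _ _)
  Thm-sound 𝔸⊨Ax (K◇ φ ψ)        v = ⊤≤⇨ (□◇-distrib-⇨ _ _)
  Thm-sound 𝔸⊨Ax (ax ψ σ Ax-ψ)   v rewrite ⟦⟧-subst σ ψ v = reflexive (Eq.sym (𝔸⊨Ax ψ Ax-ψ _))
  Thm-sound 𝔸⊨Ax (mp ⊢φ⇒ψ ⊢φ)    v = ⇨-mp (Thm-sound 𝔸⊨Ax ⊢φ⇒ψ v) (Thm-sound 𝔸⊨Ax ⊢φ v)
  Thm-sound 𝔸⊨Ax (nec ⊢φ)        v = trans (reflexive (Eq.sym □-⊤)) (□-mono (Thm-sound 𝔸⊨Ax ⊢φ v))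

open CKAlgebraProperties using (⇨-mp)
open Soundness using (Thm-sound)

module _ {P : Set} {Λ Ax : FormulaSet P} where

  premises : ∀ {φ} → Λ ⊢[ Ax ] φ → List (Formula P)
  premises (premise {φ} _) = [ φ ]
  premises (theorem _)     = []
  premises (mp d e)        = premises d ++ premises e

  premises⊆ : ∀ {φ} (d : Λ ⊢[ Ax ] φ) → FiniteSubsetOf (premises d) Λ
  premises⊆ (premise Λφ) = Λφ ∷ []
  premises⊆ (theorem _)  = []
  premises⊆ (mp d e)     = ++⁺ (premises⊆ d) (premises⊆ e)

  ⊢-sound : ∀ {φ} (d : Λ ⊢[ Ax ] φ) → DegreeConseq Ax (premises d) φ
  ⊢-sound (premise _) 𝔸 𝔸⊨Ax v a (a≤φ ∷ []) = a≤φ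
  ⊢-sound (theorem ⊢φ) 𝔸 𝔸⊨Ax v a _ =
    CKAlgebra.trans 𝔸 (CKAlgebra.maximum 𝔸 a) (Thm-sound 𝔸 𝔸⊨Ax ⊢φ v)
  ⊢-sound (mp d e) 𝔸 𝔸⊨Ax v a a≤premises =
    ⇨-mp 𝔸 (⊢-sound d 𝔸 𝔸⊨Ax v a (++⁻ˡ (premises d) a≤premises))
           (⊢-sound e 𝔸 𝔸⊨Ax v a (++⁻ʳ (premises d) a≤premises))

subst-var : {P : Set} (φ : Formula P) → subst var φ ≡ φ
subst-var (var p)  = refl
subst-var ⊥'       = refl
subst-var (φ ∧' ψ) = cong₂ _∧'_ (subst-var φ) (subst-var ψ)
subst-var (φ ∨' ψ) = cong₂ _∨'_ (subst-var φ) (subst-var ψ)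
subst-var (φ ⇒ ψ)  = cong₂ _⇒_ (subst-var φ) (subst-var ψ)
subst-var (□ φ)    = cong □_ (subst-var φ)
subst-var (◇ φ)    = cong ◇_ (subst-var φ)

module Lindenbaum {P : Set} (Ax : FormulaSet P) where

  infix 4 _⊩_ _≤ᴸ_ _≈ᴸ_

  _⊩_ : List (Formula P) → Formula P → Set
  Γ ⊩ φ = (_∈ Γ) ⊢[ Ax ] φ

  ⇒-refl : ∀ φ → Thm Ax (φ ⇒ φ)
  ⇒-refl φ = mp (mp (ipc-S φ (φ ⇒ φ) φ) (ipc-K φ (φ ⇒ φ))) (ipc-K φ φ)

  deduction : ∀ {Γ ψ φ} → ψ ∷ Γ ⊩ φ → Γ ⊩ ψ ⇒ φ
  deduction (premise (here refl)) = theorem (⇒-refl _)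
  deduction (premise (there φ∈Γ)) = mp (theorem (ipc-K _ _)) (premise φ∈Γ)
  deduction (theorem ⊢φ)          = mp (theorem (ipc-K _ _)) (theorem ⊢φ)
  deduction (mp d e)              = mp (mp (theorem (ipc-S _ _ _)) (deduction d)) (deduction e)

  []⊩⇒Thm : ∀ {φ} → [] ⊩ φ → Thm Ax φ
  []⊩⇒Thm (premise ())
  []⊩⇒Thm (theorem ⊢φ) = ⊢φ
  []⊩⇒Thm (mp d e)     = mp ([]⊩⇒Thm d) ([]⊩⇒Thm e)

  _≤ᴸ_ : Formula P → Formula P → Set
  φ ≤ᴸ ψ = Thm Ax (φ ⇒ ψ)

  _≈ᴸ_ : Formula P → Formula P → Set
  φ ≈ᴸ ψ = φ ≤ᴸ ψ × ψ ≤ᴸ φ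

  ≤ᴸ-intro : ∀ {φ ψ} → [ φ ] ⊩ ψ → φ ≤ᴸ ψ
  ≤ᴸ-intro φ⊩ψ = []⊩⇒Thm (deduction φ⊩ψ)

  ≤ᴸ-theorem : ∀ {φ ψ} → Thm Ax ψ → φ ≤ᴸ ψ
  ≤ᴸ-theorem ⊢ψ = mp (ipc-K _ _) ⊢ψ

  hyp₀ : ∀ {Γ φ} → φ ∷ Γ ⊩ φ
  hyp₀ = premise (here refl)

  hyp₁ : ∀ {Γ φ ψ} → ψ ∷ φ ∷ Γ ⊩ φ
  hyp₁ = premise (there (here refl))

  apply : ∀ {Γ φ ψ} → φ ≤ᴸ ψ → Γ ⊩ φ → Γ ⊩ ψ
  apply φ≤ψ Γ⊩φ = mp (theorem φ≤ψ) Γ⊩φ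

  ∧-intro : ∀ {Γ φ ψ} → Γ ⊩ φ → Γ ⊩ ψ → Γ ⊩ φ ∧' ψ
  ∧-intro Γ⊩φ Γ⊩ψ = mp (mp (theorem (ipc-∧I _ _)) Γ⊩φ) Γ⊩ψ

  ∧-elim₁ : ∀ {Γ φ ψ} → Γ ⊩ φ ∧' ψ → Γ ⊩ φ
  ∧-elim₁ = apply (ipc-∧E₁ _ _)

  ∧-elim₂ : ∀ {Γ φ ψ} → Γ ⊩ φ ∧' ψ → Γ ⊩ ψ
  ∧-elim₂ = apply (ipc-∧E₂ _ _)

  ≤ᴸ-trans : ∀ {φ ψ χ} → φ ≤ᴸ ψ → ψ ≤ᴸ χ → φ ≤ᴸ χ
  ≤ᴸ-trans φ≤ψ ψ≤χ = ≤ᴸ-intro (apply ψ≤χ (apply φ≤ψ hyp₀))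

  □-mono : ∀ {φ ψ} → φ ≤ᴸ ψ → □ φ ≤ᴸ □ ψ
  □-mono φ≤ψ = mp (K□ _ _) (nec φ≤ψ)

  ◇-mono : ∀ {φ ψ} → φ ≤ᴸ ψ → ◇ φ ≤ᴸ ◇ ψ
  ◇-mono φ≤ψ = mp (K◇ _ _) (nec φ≤ψ)

  ≤ᴸ-isPartialOrder : IsPartialOrder _≈ᴸ_ _≤ᴸ_
  ≤ᴸ-isPartialOrder = record
    { isPreorder = record
      { isEquivalence = record
        { refl  = ⇒-refl _ , ⇒-refl _
        ; sym   = λ (φ≤ψ , ψ≤φ) → ψ≤φ , φ≤ψ
        ; trans = λ (φ≤ψ , ψ≤φ) (ψ≤χ , χ≤ψ) → ≤ᴸ-trans φ≤ψ ψ≤χ , ≤ᴸ-trans χ≤ψ ψ≤φ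
        }
      ; reflexive = proj₁
      ; trans     = ≤ᴸ-trans
      }
    ; antisym = _,_
    }

  ∨-supremum : Supremum _≤ᴸ_ _∨'_
  ∨-supremum φ ψ = ipc-∨I₁ φ ψ , ipc-∨I₂ φ ψ ,
    λ χ φ≤χ ψ≤χ → mp (mp (ipc-∨E φ ψ χ) φ≤χ) ψ≤χ

  ∧-infimum : Infimum _≤ᴸ_ _∧'_
  ∧-infimum φ ψ = ipc-∧E₁ φ ψ , ipc-∧E₂ φ ψ ,
    λ χ χ≤φ χ≤ψ → ≤ᴸ-intro (∧-intro (apply χ≤φ hyp₀) (apply χ≤ψ hyp₀))

  ⇒-exponential : Exponential _≤ᴸ_ _∧'_ _⇒_
  ⇒-exponential χ φ ψ =
    (λ χ∧φ≤ψ → ≤ᴸ-intro (deduction (apply χ∧φ≤ψ (∧-intro hyp₁ hyp₀)))) ,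
    (λ χ≤φ⇒ψ → ≤ᴸ-intro (mp (apply χ≤φ⇒ψ (∧-elim₁ hyp₀)) (∧-elim₂ hyp₀)))

  heytingᴸ : HeytingAlgebra 0ℓ 0ℓ 0ℓ
  heytingᴸ = record
    { Carrier = Formula P ; _≈_ = _≈ᴸ_ ; _≤_ = _≤ᴸ_
    ; _∨_ = _∨'_ ; _∧_ = _∧'_ ; _⇨_ = _⇒_ ; ⊤ = ⊤' ; ⊥ = ⊥'
    ; isHeytingAlgebra = record
      { isBoundedLattice = record
        { isLattice = record
          { isPartialOrder = ≤ᴸ-isPartialOrder
          ; supremum       = ∨-supremum
          ; infimum        = ∧-infimum
          }
        ; maximum = λ φ → ≤ᴸ-theorem (⇒-refl ⊥')
        ; minimum = ipc-⊥E
        }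
      ; exponential = ⇒-exponential
      }
    }

  □-∧I : ∀ {Γ φ ψ} → Γ ⊩ □ φ → Γ ⊩ □ (ψ ⇒ φ ∧' ψ)
  □-∧I = apply (□-mono (ipc-∧I _ _))

  □-∧-≥ : ∀ φ ψ → □ φ ∧' □ ψ ≤ᴸ □ (φ ∧' ψ)
  □-∧-≥ φ ψ = ≤ᴸ-intro (mp (apply (K□ _ _) (□-∧I (∧-elim₁ hyp₀))) (∧-elim₂ hyp₀))

  □-∧-≤ : ∀ φ ψ → □ (φ ∧' ψ) ≤ᴸ □ φ ∧' □ ψ
  □-∧-≤ φ ψ = ≤ᴸ-intro (∧-intro (apply (□-mono (ipc-∧E₁ φ ψ)) hyp₀)
                                 (apply (□-mono (ipc-∧E₂ φ ψ)) hyp₀))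

  □◇-≤ : ∀ φ ψ → □ φ ∧' ◇ ψ ≤ᴸ ◇ (φ ∧' ψ)
  □◇-≤ φ ψ = ≤ᴸ-intro (mp (apply (K◇ _ _) (□-∧I (∧-elim₁ hyp₀))) (∧-elim₂ hyp₀))

  lindenbaum : CKAlgebra
  lindenbaum = record
    { heyting = heytingᴸ
    ; □ᴬ = □_
    ; ◇ᴬ = ◇_
    ; □-cong = λ (φ≤ψ , ψ≤φ) → □-mono φ≤ψ , □-mono ψ≤φ
    ; ◇-cong = λ (φ≤ψ , ψ≤φ) → ◇-mono φ≤ψ , ◇-mono ψ≤φ
    ; □-⊤ = ≤ᴸ-theorem (⇒-refl ⊥') , ≤ᴸ-theorem (nec (⇒-refl ⊥'))
    ; □-∧ = λ φ ψ → □-∧-≥ φ ψ , □-∧-≤ φ ψ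
    ; ◇-∨ = λ φ ψ → ◇-mono (ipc-∨I₁ φ ψ)
    ; □◇ = □◇-≤
    }

  ⟦⟧-lindenbaum : (φ : Formula P) (σ : P → Formula P) → ⟦ lindenbaum ⟧ φ σ ≡ subst σ φ
  ⟦⟧-lindenbaum (var p)  σ = refl
  ⟦⟧-lindenbaum ⊥'       σ = refl
  ⟦⟧-lindenbaum (φ ∧' ψ) σ = cong₂ _∧'_ (⟦⟧-lindenbaum φ σ) (⟦⟧-lindenbaum ψ σ)
  ⟦⟧-lindenbaum (φ ∨' ψ) σ = cong₂ _∨'_ (⟦⟧-lindenbaum φ σ) (⟦⟧-lindenbaum ψ σ)
  ⟦⟧-lindenbaum (φ ⇒ ψ)  σ = cong₂ _⇒_ (⟦⟧-lindenbaum φ σ) (⟦⟧-lindenbaum ψ σ)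
  ⟦⟧-lindenbaum (□ φ)    σ = cong □_ (⟦⟧-lindenbaum φ σ)
  ⟦⟧-lindenbaum (◇ φ)    σ = cong ◇_ (⟦⟧-lindenbaum φ σ)

  ⟦⟧-lindenbaum-var : (φ : Formula P) → ⟦ lindenbaum ⟧ φ var ≡ φ
  ⟦⟧-lindenbaum-var φ = ≡.trans (⟦⟧-lindenbaum φ var) (subst-var φ)

  lindenbaum∈Alg : InAlg Ax lindenbaum
  lindenbaum∈Alg ψ Ax-ψ σ rewrite ⟦⟧-lindenbaum ψ σ =
    ≤ᴸ-theorem (⇒-refl ⊥') , ≤ᴸ-theorem (ax ψ σ Ax-ψ)

  ⋀ : List (Formula P) → Formula P
  ⋀ []       = ⊤'
  ⋀ (φ ∷ Γ) = φ ∧' ⋀ Γ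

  ⋀-≤ᴸ : (Γ : List (Formula P)) → All (⋀ Γ ≤ᴸ_) Γ
  ⋀-≤ᴸ []      = []
  ⋀-≤ᴸ (φ ∷ Γ) = ipc-∧E₁ φ (⋀ Γ) ∷ All.map (≤ᴸ-trans (ipc-∧E₂ φ (⋀ Γ))) (⋀-≤ᴸ Γ)

  ⊢-⋀ : ∀ {Λ Γ} → FiniteSubsetOf Γ Λ → Λ ⊢[ Ax ] ⋀ Γ
  ⊢-⋀ []         = theorem (⇒-refl ⊥')
  ⊢-⋀ (Λφ ∷ Γ⊆Λ) = mp (mp (theorem (ipc-∧I _ _)) (premise Λφ)) (⊢-⋀ Γ⊆Λ)

  DegreeConseq⇒≤ᴸ : ∀ {Γ φ} → DegreeConseq Ax Γ φ → ⋀ Γ ≤ᴸ φ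
  DegreeConseq⇒≤ᴸ {Γ} {φ} Γ⊨φ = ≡.subst (⋀ Γ ≤ᴸ_) (⟦⟧-lindenbaum-var φ)
    (Γ⊨φ lindenbaum lindenbaum∈Alg var (⋀ Γ)
      (All.map (λ {ψ} → ≡.subst (⋀ Γ ≤ᴸ_) (≡.sym (⟦⟧-lindenbaum-var ψ))) (⋀-≤ᴸ Γ)))

  complete : ∀ {Λ Γ φ} → FiniteSubsetOf Γ Λ → DegreeConseq Ax Γ φ → Λ ⊢[ Ax ] φ
  complete Γ⊆Λ Γ⊨φ = mp (theorem (DegreeConseq⇒≤ᴸ Γ⊨φ)) (⊢-⋀ Γ⊆Λ)

theorem2p9 : (Prop : Set) (Ax : FormulaSet Prop) (Λ : FormulaSet Prop) (φ : Formula Prop) → (Λ ⊢[ Ax ] φ) ⇔ Σ (List (Formula Prop)) (λ Λ' → FiniteSubsetOf Λ' Λ × DegreeConseq Ax Λ' φ)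
theorem2p9 Prop Ax Λ φ = mk⇔
  (λ d → premises d , premises⊆ d , ⊢-sound d)
  (λ (Λ' , Λ'⊆Λ , Λ'⊨φ) → Lindenbaum.complete Ax Λ'⊆Λ Λ'⊨φ)
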